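{- Let $n>2k$. Let $S\subseteq[n]$ and $T\subseteq[2,n]$ be sets with $j=\max T$, $S\cap T=\{j\}$, $S\cup T=[j]$, $|S\cap[2,n]|\le k-1$, $|T|\le k$, and let $\mathcal A=\mathcal L(S,k-1)$, $\mathcal B=\mathcal L(T,k)$ (these are cross-intersecting). Suppose there exists $i$ with $4\le i\le j$ and $|[i]\setminus S|\le|S\cap[i]|$. Put $T'=[i]\setminus S$, and let $S'\subseteq[n]$ be any set with $S'\cap T'=\{\max T'\}$ and $S'\cup T'=[\max T']$. Then $\mathcal A'=\mathcal L(S',k-1)$ and $\mathcal B'=\mathcal L(T',k)$ are cross-intersecting and satisfy $|\mathcal A'|+|\mathcal B'|\ge|\mathcal A|+|\mathcal B|$ and $|\mathcal B'|>|\mathcal B|$. Moreover, if $|[i]\setminus S|<|S\cap[i]|$, then $|\mathcal A'|+|\mathcal B'|>|\mathcal A|+|\mathcal B|$.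
   Context: $[a,b]=\{a,\dots,b\}$, $[j]=\{1,\dots,j\}$. Families $\mathcal A,\mathcal B$ are cross-intersecting if $A\cap B\ne\emptyset$ for all $A\in\mathcal A,B\in\mathcal B$. Lexicographic order: for distinct finite sets $A,B$, $A<B$ iff $\min(A\triangle B)\in A$; $A\le B$ means $A<B$ or $A=B$. For $X\subseteq[n]$ and integer $a$, $\mathcal L(X,a)=\{A\in\binom{[2,n]}{a}: A\le X\cap[2,n]\}$. -}

module Defs where

open import Data.Nat as ℕ using (ℕ; zero; suc; _<ᵇ_; _≤ᵇ_)
open import Data.Fin as Fin using (Fin; toℕ)
open import Data.Fin.Properties using (any?; all?)
open import Data.Fin.Subset using (Subset; _∈_; _∉_; _⊆_; _∩_; Nonempty; ∣_∣)
open import Data.Fin.Subset.Properties using (_∈?_; _⊆?_)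
open import Data.Bool using (Bool; true; false)
import Data.Bool.Properties as BoolP
open import Data.Vec using (Vec; []; _∷_; tabulate)
open import Data.Vec.Properties using (≡-dec)
open import Data.List using (List; []; _∷_; map; _++_; length; filter)
open import Data.Product using (_×_; ∃; _,_)
open import Data.Sum using (_⊎_)
open import Relation.Binary.PropositionalEquality using (_≡_)
open import Relation.Nullary using (Dec; ¬_)
open import Relation.Nullary.Decidable using (_×-dec_; _⊎-dec_; _→-dec_; ¬?)

-- Convention: a subset of [n] = {1,…,n} is a characteristic vector
-- Subset n; position p : Fin n stands for the element toℕ p + 1.

elt : ∀ {n} → Fin n → ℕ
elt p = suc (toℕ p)

initSeg : ∀ {n} → ℕ → Subset n
initSeg m = tabulate (λ p → toℕ p <ᵇ m)

from2 : ∀ {n} → Subset n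
from2 = tabulate (λ p → 1 ≤ᵇ toℕ p)

IsMax : ∀ {n} → Fin n → Subset n → Set
IsMax m X = m ∈ X × (∀ q → q ∈ X → q Fin.≤ m)

-- Lexicographic order: A < B iff min(A △ B) ∈ A, i.e. there is p with
-- p ∈ A, p ∉ B, and A, B agree on all positions below p.
_<ˡ_ : ∀ {n} → Subset n → Subset n → Set
A <ˡ B = ∃ λ p → p ∈ A × p ∉ B × (∀ q → q Fin.< p → (q ∈ A → q ∈ B) × (q ∈ B → q ∈ A))

_≤ˡ_ : ∀ {n} → Subset n → Subset n → Set
A ≤ˡ B = A <ˡ B ⊎ A ≡ B

InL : ∀ {n} → Subset n → ℕ → Subset n → Set
InL X a A = A ⊆ from2 × ∣ A ∣ ≡ a × A ≤ˡ (X ∩ from2)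

CrossIntersecting : ∀ {n} → (Subset n → Set) → (Subset n → Set) → Set
CrossIntersecting {n} 𝒜 ℬ = ∀ (A B : Subset n) → 𝒜 A → ℬ B → Nonempty (A ∩ B)

_<ˡ?_ : ∀ {n} (A B : Subset n) → Dec (A <ˡ B)
A <ˡ? B = any? (λ p → (p ∈? A) ×-dec (¬? (p ∈? B)) ×-dec
             all? (λ q → (q Fin.<? p) →-dec ((q ∈? A) →-dec (q ∈? B)) ×-dec ((q ∈? B) →-dec (q ∈? A))))

_≤ˡ?_ : ∀ {n} (A B : Subset n) → Dec (A ≤ˡ B)
A ≤ˡ? B = (A <ˡ? B) ⊎-dec ≡-dec BoolP._≟_ A B

InL? : ∀ {n} (X : Subset n) (a : ℕ) (A : Subset n) → Dec (InL X a A)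
InL? X a A = (A ⊆? from2) ×-dec (∣ A ∣ ℕ.≟ a) ×-dec (A ≤ˡ? (X ∩ from2))

allSubsets : ∀ n → List (Subset n)
allSubsets zero = [] ∷ []
allSubsets (suc n) = map (true ∷_) (allSubsets n) ++ map (false ∷_) (allSubsets n)

cardL : ∀ {n} → Subset n → ℕ → ℕ
cardL {n} X a = length (filter (InL? X a) (allSubsets n))

-- Dropping the element 1, which no member of L(X,a) contains, |L(X,a)| becomes lexCount of the
-- tail of X, which obeys Pascal-type recursions position by position. The pairs (S,T) and
-- (S′,T′) coincide below m = max T′, and there both sums grow by the same binomial coefficients;
-- so it suffices to compare at m, where S′ and T′ end while S continues with a run of
-- c = |S ∩ (m,i]| elements. There the comparison becomes
-- lexCount(S after m, a) + lexCount(T after m, b) ≤ C(R, b), R the number of positions after m,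
-- whenever a ≤ b + c (strictly if a < b + c). This is proved by induction along the complementary
-- pair (S, T) after m from the unimodality of binomial coefficients; since S after m has positive
-- count, it also gives |B′| > |B|. Cross-intersection of L(S′,·) and L(T′,·) likewise follows
-- position by position along the complementary pair (S′, T′).

module Submission where

open import Defs
open import Data.Nat using (ℕ; zero; suc; _+_; _*_; _∸_; _≤_; _<_; _≥_; _>_; _⊔_; z≤n; s≤s; _≟_)
open import Data.Nat.Properties
open import Data.Nat.Combinatorics using (_C_; nCk≡nC[n∸k]; nCn≡1; k>n⇒nCk≡0; nCk+nC[k+1]≡[n+1]C[k+1])
open import Algebra.Properties.CommutativeSemigroup +-commutativeSemigroup using (x∙yz≈y∙xz)
open import Data.Bool using (true; false)
open import Data.Bool.Properties using (∧-zeroʳ)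
open import Data.Fin using (Fin; zero; suc)
import Data.Fin as Fin
open import Data.Fin.Subset using (Subset; _⊆_; _∩_; _∪_; _─_; ⁅_⁆; ∣_∣; _∈_; Nonempty; ⊤) renaming (⊥ to ∅)
open import Data.Fin.Subset.Properties using (∣⊥∣≡0; ∩-zeroˡ; ∩-zeroʳ; ∩-identityʳ; drop-there; ∈⊤)
open import Data.Vec using ([]; _∷_; tabulate; here; there)
open import Data.Vec.Properties using (∷-injectiveʳ)
open import Data.List using (List; []; _∷_; map; _++_; length; filter)
open import Data.List.Properties using (length-++; filter-++; filter-≐; filter-none)
open import Data.List.Relation.Unary.All using (universal)
open import Data.Product using (_×_; _,_; proj₁; proj₂)
open import Data.Sum using (_⊎_; inj₁; inj₂)
open import Data.Empty using (⊥; ⊥-elim)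
open import Function using (_∘_)
open import Level using (0ℓ)
open import Relation.Binary.PropositionalEquality
open import Relation.Nullary using (¬_; yes; no; does)
open import Relation.Nullary.Decidable using (_×-dec_)
open import Relation.Unary using (Pred; Decidable; _≐_)

C-zeroʳ : ∀ n → n C 0 ≡ 1
C-zeroʳ n = trans (nCk≡nC[n∸k] {0} {n} z≤n) (nCn≡1 n)

C-pascal : ∀ n k → suc n C suc k ≡ n C k + n C suc k
C-pascal n k = sym (nCk+nC[k+1]≡[n+1]C[k+1] n k)

C-pos : ∀ {n k} → k ≤ n → 0 < n C k
C-pos {n} {zero} _ = ≤-reflexive (sym (C-zeroʳ n))
C-pos {suc n} {suc k} (s≤s k≤n) rewrite C-pascal n k = ≤-trans (C-pos k≤n) (m≤m+n _ _)

C-mono-≤ : ∀ n {x y} → x ≤ y → x + y ≤ n → n C x ≤ n C y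
C-mono-≤ n {zero} {y} _ y≤n = C-pos y≤n
C-mono-≤ (suc n) {suc x} {suc y} (s≤s x≤y) x+y<n with m≤n⇒m<n∨m≡n x≤y
... | inj₂ refl = ≤-refl
... | inj₁ x<y rewrite C-pascal n x | C-pascal n y | +-comm (n C y) (n C suc y) =
  +-mono-≤ (C-mono-≤ n (m≤n⇒m≤1+n x≤y) (≤-pred x+y<n))
           (C-mono-≤ n x<y (≤-trans (≤-reflexive (sym (+-suc x y))) (≤-pred x+y<n)))

C-mono-< : ∀ n {x y} → x < y → x + y < n → n C x < n C y
C-mono-< (suc n) {zero} {suc y} _ (s≤s y<n) rewrite C-pascal n y =
  +-mono-≤ (C-pos (<⇒≤ y<n)) (C-pos y<n)
C-mono-< (suc n) {suc x} {suc y} (s≤s x<y) (s≤s x+y<n) rewrite C-pascal n x | C-pascal n y | +-comm (n C y) (n C suc y) =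
  +-mono-<-≤ (C-mono-< n (m≤n⇒m≤1+n x<y) x+y<n)
             (C-mono-≤ n x<y (≤-trans (≤-reflexive (sym (+-suc x y))) (<⇒≤ x+y<n)))

withFirst : ℕ → ℕ → ℕ
withFirst n zero = 0
withFirst n (suc k) = n C k

C-suc : ∀ n k → suc n C k ≡ withFirst n k + n C k
C-suc n zero = trans (C-zeroʳ (suc n)) (sym (C-zeroʳ n))
C-suc n (suc k) = C-pascal n k

-- lexCount X a = |{A : |A| = a, A ≤ˡ X}| (count-lex); if X misses the first position,
-- every a-set containing it precedes X.
lexCount : ∀ {n} → Subset n → ℕ → ℕ
lexCount [] zero = 1
lexCount [] (suc a) = 0
lexCount (true ∷ X) zero = 0
lexCount (true ∷ X) (suc a) = lexCount X a
lexCount {suc n} (false ∷ X) a = withFirst n a + lexCount X a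

lexCount-∅ : ∀ n a → lexCount (∅ {n}) a ≡ n C a
lexCount-∅ zero zero = refl
lexCount-∅ zero (suc a) = sym (k>n⇒nCk≡0 {0} {suc a} (s≤s z≤n))
lexCount-∅ (suc n) a = trans (cong (withFirst n a +_) (lexCount-∅ n a)) (sym (C-suc n a))

lexCount-pos : ∀ {n} (X : Subset n) {a} → ∣ X ∣ ≤ a → a ≤ n → 0 < lexCount X a
lexCount-pos [] {zero} _ _ = s≤s z≤n
lexCount-pos (true ∷ X) {suc a} (s≤s ∣X∣≤a) (s≤s a≤n) = lexCount-pos X ∣X∣≤a a≤n
lexCount-pos (false ∷ X) {zero} ∣X∣≤0 _ = lexCount-pos X ∣X∣≤0 z≤n
lexCount-pos (false ∷ X) {suc a} _ (s≤s a≤n) = ≤-trans (C-pos a≤n) (m≤m+n _ _)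

count : ∀ {n} {P : Pred (Subset n) 0ℓ} → Decidable P → ℕ
count {n} P? = length (filter P? (allSubsets n))

count-≐ : ∀ {n} {P Q : Pred (Subset n) 0ℓ} (P? : Decidable P) (Q? : Decidable Q) → P ≐ Q → count P? ≡ count Q?
count-≐ {n} P? Q? P≐Q = cong length (filter-≐ P? Q? P≐Q (allSubsets n))

count-none : ∀ {n} {P : Pred (Subset n) 0ℓ} (P? : Decidable P) → (∀ A → ¬ P A) → count P? ≡ 0
count-none {n} P? ¬P = cong length (filter-none P? (universal ¬P (allSubsets n)))

length-filter-map : ∀ {A B : Set} {P : Pred B 0ℓ} (P? : Decidable P) (f : A → B) (xs : List A) →
  length (filter P? (map f xs)) ≡ length (filter (P? ∘ f) xs)
length-filter-map P? f [] = refl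
length-filter-map P? f (x ∷ xs) with does (P? (f x))
... | true = cong suc (length-filter-map P? f xs)
... | false = length-filter-map P? f xs

count-∷ : ∀ {n} {P : Pred (Subset (suc n)) 0ℓ} (P? : Decidable P) →
  count P? ≡ count (P? ∘ (true ∷_)) + count (P? ∘ (false ∷_))
count-∷ {n} P? = begin
  length (filter P? (map (true ∷_) xs ++ map (false ∷_) xs))
    ≡⟨ cong length (filter-++ P? (map (true ∷_) xs) (map (false ∷_) xs)) ⟩
  length (filter P? (map (true ∷_) xs) ++ filter P? (map (false ∷_) xs))
    ≡⟨ length-++ (filter P? (map (true ∷_) xs)) ⟩
  length (filter P? (map (true ∷_) xs)) + length (filter P? (map (false ∷_) xs))
    ≡⟨ cong₂ _+_ (length-filter-map P? (true ∷_) xs) (length-filter-map P? (false ∷_) xs) ⟩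
  count (P? ∘ (true ∷_)) + count (P? ∘ (false ∷_)) ∎
  where
  open ≡-Reasoning
  xs = allSubsets n

<ˡ-here : ∀ {n} {A B : Subset n} → (true ∷ A) <ˡ (false ∷ B)
<ˡ-here = zero , here , (λ ()) , (λ _ ())

<ˡ-there : ∀ {n x} {A B : Subset n} → A <ˡ B → (x ∷ A) <ˡ (x ∷ B)
<ˡ-there {x = x} {A} {B} (p , p∈A , p∉B , agree) = suc p , there p∈A , p∉B ∘ drop-there , agree′
  where
  agree′ : ∀ q → q Fin.< suc p → (q ∈ x ∷ A → q ∈ x ∷ B) × (q ∈ x ∷ B → q ∈ x ∷ A)
  agree′ zero _ = (λ { here → here }) , (λ { here → here })
  agree′ (suc q) (s≤s q<p) =
    (there ∘ proj₁ (agree q q<p) ∘ drop-there) , (there ∘ proj₂ (agree q q<p) ∘ drop-there)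

<ˡ-∷⁻ : ∀ {n x y} {A B : Subset n} → (x ∷ A) <ˡ (y ∷ B) →
  (x ≡ true × y ≡ false) ⊎ (x ≡ y × A <ˡ B)
<ˡ-∷⁻ {y = true} (zero , here , z∉B , _) = ⊥-elim (z∉B here)
<ˡ-∷⁻ {y = false} (zero , here , _ , _) = inj₁ (refl , refl)
<ˡ-∷⁻ {x = x} {y} {A} {B} (suc p , p∈A , p∉B , agree) =
  inj₂ (heads-agree x y (agree zero (s≤s z≤n)) , p , drop-there p∈A , p∉B ∘ there , agree′)
  where
  heads-agree : ∀ x y → (zero ∈ x ∷ A → zero ∈ y ∷ B) × (zero ∈ y ∷ B → zero ∈ x ∷ A) → x ≡ y
  heads-agree true true _ = refl
  heads-agree false false _ = refl
  heads-agree true false (to , _) with to here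
  ... | ()
  heads-agree false true (_ , from) with from here
  ... | ()
  agree′ : ∀ q → q Fin.< p → (q ∈ A → q ∈ B) × (q ∈ B → q ∈ A)
  agree′ q q<p =
    (drop-there ∘ proj₁ (agree (suc q) (s≤s q<p)) ∘ there) , (drop-there ∘ proj₂ (agree (suc q) (s≤s q<p)) ∘ there)

≤ˡ-∷⁻ : ∀ {n x y} {A B : Subset n} → (x ∷ A) ≤ˡ (y ∷ B) →
  (x ≡ true × y ≡ false) ⊎ (x ≡ y × A ≤ˡ B)
≤ˡ-∷⁻ (inj₁ A<B) with <ˡ-∷⁻ A<B
... | inj₁ heads = inj₁ heads
... | inj₂ (x≡y , A<B′) = inj₂ (x≡y , inj₁ A<B′)
≤ˡ-∷⁻ (inj₂ refl) = inj₂ (refl , inj₂ refl)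

≤ˡ-∷⁺ : ∀ {n x y} {A B : Subset n} → (x ≡ true × y ≡ false) ⊎ (x ≡ y × A ≤ˡ B) →
  (x ∷ A) ≤ˡ (y ∷ B)
≤ˡ-∷⁺ (inj₁ (refl , refl)) = inj₁ <ˡ-here
≤ˡ-∷⁺ (inj₂ (refl , inj₁ A<B)) = inj₁ (<ˡ-there A<B)
≤ˡ-∷⁺ (inj₂ (refl , inj₂ refl)) = inj₂ refl

count-[] : ∀ {P : Pred (Subset 0) 0ℓ} (P? : Decidable P) → P [] → count P? ≡ 1
count-[] P? p with P? []
... | yes _ = refl
... | no ¬p = ⊥-elim (¬p p)

count-size : ∀ n a → count (λ (A : Subset n) → ∣ A ∣ ≟ a) ≡ n C a
count-true∷-size : ∀ n a → count (λ (A : Subset n) → ∣ true ∷ A ∣ ≟ a) ≡ withFirst n a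

count-size zero zero = trans (count-[] (λ A → ∣ A ∣ ≟ 0) refl) (sym (C-zeroʳ 0))
count-size zero (suc a) = sym (k>n⇒nCk≡0 {0} {suc a} (s≤s z≤n))
count-size (suc n) a = begin
  count (λ (A : Subset (suc n)) → ∣ A ∣ ≟ a)  ≡⟨ count-∷ (λ (A : Subset (suc n)) → ∣ A ∣ ≟ a) ⟩
  count (λ (A : Subset n) → ∣ true ∷ A ∣ ≟ a) + count (λ (A : Subset n) → ∣ A ∣ ≟ a)
    ≡⟨ cong₂ _+_ (count-true∷-size n a) (count-size n a) ⟩
  withFirst n a + n C a  ≡⟨ C-suc n a ⟨
  suc n C a ∎
  where open ≡-Reasoning

count-true∷-size n zero = count-none (λ (A : Subset n) → ∣ true ∷ A ∣ ≟ 0) (λ _ ())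
count-true∷-size n (suc a) =
  trans (count-≐ (λ (A : Subset n) → ∣ true ∷ A ∣ ≟ suc a) (λ A → ∣ A ∣ ≟ a) (suc-injective , cong suc))
        (count-size n a)

false∷≰ˡtrue∷ : ∀ {n} {A B : Subset n} → ¬ (false ∷ A) ≤ˡ (true ∷ B)
false∷≰ˡtrue∷ A≤B with ≤ˡ-∷⁻ A≤B
... | inj₁ (() , _)
... | inj₂ (() , _)

≤ˡ-tail : ∀ {n x} {A B : Subset n} → (x ∷ A) ≤ˡ (x ∷ B) → A ≤ˡ B
≤ˡ-tail {x = true} A≤B with ≤ˡ-∷⁻ A≤B
... | inj₂ (_ , A≤B′) = A≤B′
≤ˡ-tail {x = false} A≤B with ≤ˡ-∷⁻ A≤B
... | inj₁ (() , _)
... | inj₂ (_ , A≤B′) = A≤B′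

≤ˡ-true∷ : ∀ {n a} {A X : Subset n} → (a ∷ A) ≤ˡ (true ∷ X) → a ≡ true × A ≤ˡ X
≤ˡ-true∷ A≤X with ≤ˡ-∷⁻ A≤X
... | inj₂ (refl , A≤X′) = refl , A≤X′

count-lex : ∀ {n} (X : Subset n) a → count (λ A → (∣ A ∣ ≟ a) ×-dec (A ≤ˡ? X)) ≡ lexCount X a
count-lex [] zero = count-[] (λ A → (∣ A ∣ ≟ 0) ×-dec (A ≤ˡ? [])) (refl , inj₂ refl)
count-lex [] (suc a) = count-none (λ A → (∣ A ∣ ≟ suc a) ×-dec (A ≤ˡ? [])) (λ { [] (() , _) })
count-lex (true ∷ X) zero = count-none (λ A → (∣ A ∣ ≟ 0) ×-dec (A ≤ˡ? (true ∷ X))) none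
  where
  none : ∀ A → ¬ (∣ A ∣ ≡ 0 × A ≤ˡ (true ∷ X))
  none (true ∷ A) (() , _)
  none (false ∷ A) (_ , A≤X) = false∷≰ˡtrue∷ A≤X
count-lex {suc n} (true ∷ X) (suc a) = begin
  count P?  ≡⟨ count-∷ P? ⟩
  count (P? ∘ (true ∷_)) + count (P? ∘ (false ∷_))
    ≡⟨ cong₂ _+_ (count-≐ (P? ∘ (true ∷_)) Q? ((λ (e , A≤X) → suc-injective e , ≤ˡ-tail A≤X) ,
                                               (λ (e , A≤X) → cong suc e , ≤ˡ-∷⁺ (inj₂ (refl , A≤X)))))
                 (count-none (P? ∘ (false ∷_)) (λ A (_ , A≤X) → false∷≰ˡtrue∷ A≤X)) ⟩
  count Q? + 0  ≡⟨ +-identityʳ _ ⟩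
  count Q?      ≡⟨ count-lex X a ⟩
  lexCount X a ∎
  where
  open ≡-Reasoning
  P? = λ (A : Subset (suc n)) → (∣ A ∣ ≟ suc a) ×-dec (A ≤ˡ? (true ∷ X))
  Q? = λ (A : Subset n) → (∣ A ∣ ≟ a) ×-dec (A ≤ˡ? X)
count-lex {suc n} (false ∷ X) a = begin
  count P?  ≡⟨ count-∷ P? ⟩
  count (P? ∘ (true ∷_)) + count (P? ∘ (false ∷_))
    ≡⟨ cong₂ _+_ (count-≐ (P? ∘ (true ∷_)) (λ A → ∣ true ∷ A ∣ ≟ a)
                          (proj₁ , (_, ≤ˡ-∷⁺ (inj₁ (refl , refl)))))
                 (count-≐ (P? ∘ (false ∷_)) Q? ((λ (e , A≤X) → e , ≤ˡ-tail A≤X) ,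
                                                (λ (e , A≤X) → e , ≤ˡ-∷⁺ (inj₂ (refl , A≤X))))) ⟩
  count (λ (A : Subset n) → ∣ true ∷ A ∣ ≟ a) + count Q?
    ≡⟨ cong₂ _+_ (count-true∷-size n a) (count-lex X a) ⟩
  withFirst n a + lexCount X a ∎
  where
  open ≡-Reasoning
  P? = λ (A : Subset (suc n)) → (∣ A ∣ ≟ a) ×-dec (A ≤ˡ? (false ∷ X))
  Q? = λ (A : Subset n) → (∣ A ∣ ≟ a) ×-dec (A ≤ˡ? X)

tabulate-true : ∀ {n} → tabulate (λ (_ : Fin n) → true) ≡ ⊤
tabulate-true {zero} = refl
tabulate-true {suc n} = cong (true ∷_) tabulate-true

∷∩from2 : ∀ {n} x (X : Subset n) → (x ∷ X) ∩ from2 ≡ false ∷ X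
∷∩from2 x X = cong₂ _∷_ (∧-zeroʳ x) (trans (cong (X ∩_) tabulate-true) (∩-identityʳ X))

InL-∷⁻ : ∀ {n x y a} {X A : Subset n} → InL (x ∷ X) a (y ∷ A) → y ≡ false × ∣ A ∣ ≡ a × A ≤ˡ X
InL-∷⁻ {y = true} (A⊆from2 , _) with A⊆from2 here
... | ()
InL-∷⁻ {x = x} {false} {X = X} (_ , ∣A∣≡a , A≤X) rewrite ∷∩from2 x X = refl , ∣A∣≡a , ≤ˡ-tail A≤X

InL-∷⁺ : ∀ {n x a} {X A : Subset n} → ∣ A ∣ ≡ a → A ≤ˡ X → InL (x ∷ X) a (false ∷ A)
InL-∷⁺ {x = x} {X = X} {A} ∣A∣≡a A≤X =
  A⊆from2 , ∣A∣≡a , subst ((false ∷ A) ≤ˡ_) (sym (∷∩from2 x X)) (≤ˡ-∷⁺ (inj₂ (refl , A≤X)))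
  where
  A⊆from2 : ∀ {q} → q ∈ false ∷ _ → q ∈ from2
  A⊆from2 {suc q} _ = there (subst (q ∈_) (sym tabulate-true) ∈⊤)

cardL-∷ : ∀ {n} x (X : Subset n) a → cardL (x ∷ X) a ≡ lexCount X a
cardL-∷ {n} x X a = begin
  count (InL? (x ∷ X) a)  ≡⟨ count-∷ (InL? (x ∷ X) a) ⟩
  count (InL? (x ∷ X) a ∘ (true ∷_)) + count (InL? (x ∷ X) a ∘ (false ∷_))
    ≡⟨ cong₂ _+_ (count-none (InL? (x ∷ X) a ∘ (true ∷_)) (λ A A∈L → true≢false (proj₁ (InL-∷⁻ A∈L))))
                 (count-≐ (InL? (x ∷ X) a ∘ (false ∷_)) Q?
                          (proj₂ ∘ InL-∷⁻ , λ (e , A≤X) → InL-∷⁺ e A≤X)) ⟩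
  0 + count Q?  ≡⟨ count-lex X a ⟩
  lexCount X a ∎
  where
  open ≡-Reasoning
  Q? = λ (A : Subset n) → (∣ A ∣ ≟ a) ×-dec (A ≤ˡ? X)
  true≢false : true ≡ false → ⊥
  true≢false ()

-- Split j V U is the paper's V ∩ U = {j}, V ∪ U = [j], read off position by position.
data Split : ∀ {n} → Fin n → Subset n → Subset n → Set where
  last  : ∀ {n} → Split zero (true ∷ ∅ {n}) (true ∷ ∅)
  left  : ∀ {n j} {V U : Subset n} → Split j V U → Split (suc j) (true ∷ V) (false ∷ U)
  right : ∀ {n j} {V U : Subset n} → Split j V U → Split (suc j) (false ∷ V) (true ∷ U)

initSeg-zero : ∀ {n} → initSeg {n} 0 ≡ ∅
initSeg-zero {zero} = refl
initSeg-zero {suc n} = cong (false ∷_) initSeg-zero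

∪≡∅ : ∀ {n} {V U : Subset n} → V ∪ U ≡ ∅ → V ≡ ∅ × U ≡ ∅
∪≡∅ {V = []} {[]} _ = refl , refl
∪≡∅ {V = false ∷ V} {false ∷ U} eq with ∪≡∅ (∷-injectiveʳ eq)
... | refl , refl = refl , refl

split : ∀ {n j} {V U : Subset n} → V ∩ U ≡ ⁅ j ⁆ → V ∪ U ≡ initSeg (elt j) → Split j V U
split {j = zero} {true ∷ V} {true ∷ U} _ V∪U with ∪≡∅ (trans (∷-injectiveʳ V∪U) initSeg-zero)
... | refl , refl = last
split {j = suc j} {true ∷ V} {false ∷ U} V∩U V∪U = left (split (∷-injectiveʳ V∩U) (∷-injectiveʳ V∪U))
split {j = suc j} {false ∷ V} {true ∷ U} V∩U V∪U = right (split (∷-injectiveʳ V∩U) (∷-injectiveʳ V∪U))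

Split⇒0<∣V∣ : ∀ {n j} {V U : Subset n} → Split j V U → 0 < ∣ V ∣
Split⇒0<∣V∣ last = s≤s z≤n
Split⇒0<∣V∣ (left _) = s≤s z≤n
Split⇒0<∣V∣ (right s) = Split⇒0<∣V∣ s

Split⇒0<∣U∣ : ∀ {n j} {V U : Subset n} → Split j V U → 0 < ∣ U ∣
Split⇒0<∣U∣ last = s≤s z≤n
Split⇒0<∣U∣ (left s) = Split⇒0<∣U∣ s
Split⇒0<∣U∣ (right _) = s≤s z≤n

initSeg-zero-─ : ∀ {n} (X : Subset n) → initSeg 0 ─ X ≡ ∅
initSeg-zero-─ [] = refl
initSeg-zero-─ (true ∷ X) = cong (false ∷_) (initSeg-zero-─ X)
initSeg-zero-─ (false ∷ X) = cong (false ∷_) (initSeg-zero-─ X)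

¬Split-∅ʳ : ∀ {n j} {V : Subset n} → ¬ Split j V ∅
¬Split-∅ʳ {n} s = <⇒≢ (Split⇒0<∣U∣ s) (sym (∣⊥∣≡0 n))

Split-intersects : ∀ {n j} {V U A B : Subset n} → Split j V U → A ≤ˡ V → B ≤ˡ U → Nonempty (A ∩ B)
Split-intersects {A = a ∷ A} {b ∷ B} last A≤V B≤U with ≤ˡ-true∷ A≤V | ≤ˡ-true∷ B≤U
... | refl , _ | refl , _ = zero , here
Split-intersects {A = a ∷ A} {b ∷ B} (left s) A≤V B≤U with ≤ˡ-true∷ A≤V | ≤ˡ-∷⁻ B≤U
... | refl , _ | inj₁ (refl , _) = zero , here
... | refl , A≤V′ | inj₂ (refl , B≤U′) with Split-intersects s A≤V′ B≤U′
...   | q , q∈A∩B = suc q , there q∈A∩B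
Split-intersects {A = a ∷ A} {b ∷ B} (right s) A≤V B≤U with ≤ˡ-∷⁻ A≤V | ≤ˡ-true∷ B≤U
... | inj₁ (refl , _) | refl , _ = zero , here
... | inj₂ (refl , A≤V′) | refl , B≤U′ with Split-intersects s A≤V′ B≤U′
...   | q , q∈A∩B = suc q , there q∈A∩B

Split⇒crossIntersecting : ∀ {n j a b x y} {V U : Subset n} → Split j V U →
  CrossIntersecting (InL (x ∷ V) a) (InL (y ∷ U) b)
Split⇒crossIntersecting s (_ ∷ A) (_ ∷ B) A∈L B∈L with InL-∷⁻ A∈L | InL-∷⁻ B∈L
... | refl , _ , A≤V | refl , _ , B≤U with Split-intersects s A≤V B≤U
...   | q , q∈A∩B = suc q , there q∈A∩B

+-suc-comm : ∀ a b → a + suc b ≡ b + suc a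
+-suc-comm a b = trans (+-suc a b) (trans (cong suc (+-comm a b)) (sym (+-suc b a)))

+-suc-≤ : ∀ {a x w} → a + suc x ≤ suc w → a + x ≤ w
+-suc-≤ {a} {x} {w} h = ≤-pred (subst (_≤ suc w) (+-suc a x) h)

+-suc-< : ∀ {a x w} → a + suc x < suc w → a + x < w
+-suc-< {a} {x} {w} h = subst (_≤ w) (+-suc a x) (≤-pred h)

withFirst-≤ : ∀ n {a b} → b ≤ a → a + b < n → withFirst n b ≤ n C suc a
withFirst-≤ n {a} {zero} _ _ = z≤n
withFirst-≤ n {a} {suc b} b<a a+1+b<n =
  C-mono-≤ n (m≤n⇒m≤1+n (<⇒≤ b<a)) (≤-trans (≤-reflexive (+-suc-comm b a)) (<⇒≤ a+1+b<n))

LexSumBound : ∀ {n} → Subset n → Subset n → Set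
LexSumBound {n} V U =
  ∀ {a b} → ∣ V ∣ ≤ a → ∣ U ∣ ≤ b → a + b < n → lexCount V a + lexCount U b < n C (a ⊔ b)

LexSumBound-sym : ∀ {n} (V U : Subset n) → LexSumBound V U → LexSumBound U V
LexSumBound-sym {n} V U bound {a} {b} ∣U∣≤a ∣V∣≤b a+b<n =
  subst₂ _<_ (+-comm (lexCount V b) (lexCount U a)) (cong (n C_) (⊔-comm b a))
    (bound ∣V∣≤b ∣U∣≤a (subst (_< n) (+-comm a b) a+b<n))

LexSumBound-∷ : ∀ {n} (V U : Subset n) → LexSumBound V U → LexSumBound (true ∷ V) (false ∷ U)
LexSumBound-∷ {n} V U bound {suc a} {b} (s≤s ∣V∣≤a) ∣U∣≤b (s≤s a+b<n)
  with <-≤-connex a b | bound {a} {b} ∣V∣≤a ∣U∣≤b a+b<n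
... | inj₁ a<b | IH = begin-strict
  lexCount V a + (withFirst n b + lexCount U b)
    ≡⟨ x∙yz≈y∙xz (lexCount V a) (withFirst n b) (lexCount U b) ⟩
  withFirst n b + (lexCount V a + lexCount U b)
    <⟨ +-monoʳ-< _ (subst (λ c → lexCount V a + lexCount U b < n C c) (m≤n⇒m⊔n≡n (<⇒≤ a<b)) IH) ⟩
  withFirst n b + n C b  ≡⟨ C-suc n b ⟨
  suc n C b              ≡⟨ cong (suc n C_) (m≤n⇒m⊔n≡n a<b) ⟨
  suc n C (suc a ⊔ b)    ∎
  where open ≤-Reasoning
... | inj₂ b≤a | IH = begin-strict
  lexCount V a + (withFirst n b + lexCount U b)
    ≡⟨ x∙yz≈y∙xz (lexCount V a) (withFirst n b) (lexCount U b) ⟩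
  withFirst n b + (lexCount V a + lexCount U b)
    <⟨ +-mono-≤-< (withFirst-≤ n b≤a a+b<n)
                  (subst (λ c → lexCount V a + lexCount U b < n C c) (m≥n⇒m⊔n≡m b≤a) IH) ⟩
  n C suc a + n C a    ≡⟨ +-comm (n C suc a) (n C a) ⟩
  n C a + n C suc a    ≡⟨ C-pascal n a ⟨
  suc n C suc a        ≡⟨ cong (suc n C_) (m≥n⇒m⊔n≡m (m≤n⇒m≤1+n b≤a)) ⟨
  suc n C (suc a ⊔ b)  ∎
  where open ≤-Reasoning

C+C≤C-suc : ∀ n {a b} → a ≤ suc b → a + suc b ≤ n → n C a + n C b ≤ suc n C suc b
C+C≤C-suc n {a} {b} a≤1+b a+1+b≤n = begin
  n C a + n C b      ≤⟨ +-monoˡ-≤ (n C b) (C-mono-≤ n a≤1+b a+1+b≤n) ⟩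
  n C suc b + n C b  ≡⟨ +-comm (n C suc b) (n C b) ⟩
  n C b + n C suc b  ≡⟨ C-pascal n b ⟨
  suc n C suc b      ∎
  where open ≤-Reasoning

C+C<C-suc : ∀ n {a b} → a < suc b → a + suc b < n → n C a + n C b < suc n C suc b
C+C<C-suc n {a} {b} a<1+b a+1+b<n = begin-strict
  n C a + n C b      <⟨ +-monoˡ-< (n C b) (C-mono-< n a<1+b a+1+b<n) ⟩
  n C suc b + n C b  ≡⟨ +-comm (n C suc b) (n C b) ⟩
  n C b + n C suc b  ≡⟨ C-pascal n b ⟨
  suc n C suc b      ∎
  where open ≤-Reasoning

LexSumBound-last : ∀ {n} → LexSumBound (true ∷ ∅ {n}) (true ∷ ∅)
LexSumBound-last {n} {suc a} {suc b} _ _ (s≤s a+1+b<n) rewrite lexCount-∅ n a | lexCount-∅ n b with ≤-total a b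
... | inj₁ a≤b rewrite m≤n⇒m⊔n≡n a≤b = C+C<C-suc n (s≤s a≤b) a+1+b<n
... | inj₂ b≤a rewrite m≥n⇒m⊔n≡m b≤a =
  subst (_< suc n C suc a) (+-comm (n C b) (n C a)) (C+C<C-suc n (s≤s b≤a) b+1+a<n)
  where
  b+1+a<n : b + suc a < n
  b+1+a<n = subst (_< n) (+-suc-comm a b) a+1+b<n

Split⇒LexSumBound : ∀ {n j} {V U : Subset n} → Split j V U → LexSumBound V U
Split⇒LexSumBound last = LexSumBound-last
Split⇒LexSumBound (left {V = V} {U} s) = LexSumBound-∷ V U (Split⇒LexSumBound s)
Split⇒LexSumBound (right {V = V} {U} s) =
  LexSumBound-sym (true ∷ U) (false ∷ V) (LexSumBound-∷ U V (LexSumBound-sym V U (Split⇒LexSumBound s)))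

-- initSeg L ⊆ V: each element of this initial run of V allows one more in a.
lexCount-run : ∀ {n j L} {V U : Subset n} → Split j V U → initSeg L ─ V ≡ ∅ →
  ∀ {a b} → ∣ V ∣ ≤ a → ∣ U ∣ ≤ b → a + b < n →
  (a ≤ b + ∣ V ∩ initSeg L ∣ → lexCount V a + lexCount U b ≤ n C b) ×
  (a < b + ∣ V ∩ initSeg L ∣ → lexCount V a + lexCount U b < n C b)
lexCount-run {n} {L = zero} {V} {U} s _ {a} {b} ∣V∣≤a ∣U∣≤b a+b<n =
  (λ a≤b+c → <⇒≤ (bound (drop-c a≤b+c))) , (λ a<b+c → bound (drop-c (<⇒≤ a<b+c)))
  where
  drop-c : a ≤ b + ∣ V ∩ initSeg 0 ∣ → a ≤ b
  drop-c a≤b+c rewrite initSeg-zero {n} | ∩-zeroʳ V | ∣⊥∣≡0 n | +-identityʳ b = a≤b+c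
  bound : a ≤ b → lexCount V a + lexCount U b < n C b
  bound a≤b = subst (λ c → lexCount V a + lexCount U b < n C c) (m≤n⇒m⊔n≡n a≤b)
                    (Split⇒LexSumBound s ∣V∣≤a ∣U∣≤b a+b<n)
lexCount-run {suc n} {L = suc L} last _ {suc a} {suc b} _ _ (s≤s a+1+b<n)
  rewrite lexCount-∅ n a | lexCount-∅ n b | ∩-zeroˡ (initSeg {n} L) | ∣⊥∣≡0 n | +-comm b 1 =
  (λ a≤b+1 → C+C≤C-suc n (≤-pred a≤b+1) (<⇒≤ a+1+b<n)) , (λ a<b+1 → C+C<C-suc n (≤-pred a<b+1) a+1+b<n)
lexCount-run {suc n} {L = suc L} (left {V = V} {U} s) eq {suc a} {b} (s≤s ∣V∣≤a) ∣U∣≤b (s≤s a+b<n) =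
  (λ a≤b+c → subst₂ _≤_ (sym rearrange) (sym (C-suc n b)) (+-monoʳ-≤ (withFirst n b) (proj₁ IH (shift a≤b+c))))
  , (λ a<b+c → subst₂ _<_ (sym rearrange) (sym (C-suc n b)) (+-monoʳ-< (withFirst n b) (proj₂ IH (shift a<b+c))))
  where
  IH = lexCount-run {L = L} s (∷-injectiveʳ eq) ∣V∣≤a ∣U∣≤b a+b<n
  c = ∣ V ∩ initSeg L ∣
  shift : ∀ {x} → suc x ≤ b + suc c → x ≤ b + c
  shift {x} h = ≤-pred (subst (suc x ≤_) (+-suc b c) h)
  rearrange : lexCount V a + (withFirst n b + lexCount U b) ≡ withFirst n b + (lexCount V a + lexCount U b)
  rearrange = x∙yz≈y∙xz (lexCount V a) (withFirst n b) (lexCount U b)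

record Gain (x y x′ y′ : ℕ) (P : Set) : Set where
  constructor gain
  field
    sum≤ : x + y ≤ x′ + y′
    y<y′ : y < y′
    sum< : P → x + y < x′ + y′

Gain-+ˡ : ∀ c {x y x′ y′ P} → Gain x y x′ y′ P → Gain (c + x) y (c + x′) y′ P
Gain-+ˡ c {x} {y} {x′} {y′} (gain sum≤ y<y′ sum<) = gain
  (subst₂ _≤_ (sym (+-assoc c x y)) (sym (+-assoc c x′ y′)) (+-monoʳ-≤ c sum≤))
  y<y′
  (λ p → subst₂ _<_ (sym (+-assoc c x y)) (sym (+-assoc c x′ y′)) (+-monoʳ-< c (sum< p)))

Gain-+ʳ : ∀ c {x y x′ y′ P} → Gain x y x′ y′ P → Gain x (c + y) x′ (c + y′) P
Gain-+ʳ c {x} {y} {x′} {y′} (gain sum≤ y<y′ sum<) = gain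
  (subst₂ _≤_ (sym (x∙yz≈y∙xz x c y)) (sym (x∙yz≈y∙xz x′ c y′)) (+-monoʳ-≤ c sum≤))
  (+-monoʳ-< c y<y′)
  (λ p → subst₂ _<_ (sym (x∙yz≈y∙xz x c y)) (sym (x∙yz≈y∙xz x′ c y′)) (+-monoʳ-< c (sum< p)))

Gain-weaken : ∀ {x y x′ y′} {P Q : Set} → (Q → P) → Gain x y x′ y′ P → Gain x y x′ y′ Q
Gain-weaken Q→P (gain sum≤ y<y′ sum<) = gain sum≤ y<y′ (sum< ∘ Q→P)

Gain-of-bound : ∀ c {x y z} {P : Set} → 0 < x → x + y ≤ z → (P → x + y < z) → Gain (c + x) y c z P
Gain-of-bound c {x} {y} {z} 0<x x+y≤z x+y<z = gain
  (subst (_≤ c + z) (sym (+-assoc c x y)) (+-monoʳ-≤ c x+y≤z))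
  (<-≤-trans (m<n+m y 0<x) x+y≤z)
  (λ p → subst (_< c + z) (sym (+-assoc c x y)) (+-monoʳ-< c (x+y<z p)))

Gain-at-max : ∀ {n j i a b} {S T : Subset n} → Split j S T → initSeg i ─ S ≡ ∅ →
  ∣ S ∣ ≤ a → ∣ T ∣ ≤ b → a + b < n → a ≤ b + ∣ S ∩ initSeg i ∣ →
  Gain (withFirst n a + lexCount S a) (lexCount T b) (lexCount (true ∷ ∅ {n}) a) (lexCount (∅ {n}) b)
       (a < b + ∣ S ∩ initSeg i ∣)
Gain-at-max {a = zero} s _ ∣S∣≤0 _ _ _ = ⊥-elim (<⇒≱ (Split⇒0<∣V∣ s) ∣S∣≤0)
Gain-at-max {n} {i = i} {suc a} {b} {S} s run ∣S∣≤a ∣T∣≤b a+b<n a≤b+c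
  rewrite lexCount-∅ n a | lexCount-∅ n b =
  Gain-of-bound (n C a) (lexCount-pos S ∣S∣≤a (≤-trans (m≤m+n (suc a) b) (<⇒≤ a+b<n)))
    (proj₁ bound a≤b+c) (proj₂ bound)
  where bound = lexCount-run {L = i} s run ∣S∣≤a ∣T∣≤b a+b<n

shift-gain : ∀ {n j m i a b} {S T S′ T′ : Subset n} →
  Split j S T → Split m S′ T′ → initSeg i ─ S ≡ T′ → i ≤ elt j →
  ∣ S ∣ ≤ a → ∣ T ∣ ≤ b → a + b < n → a + ∣ T′ ∣ ≤ b + ∣ S ∩ initSeg i ∣ →
  Gain (lexCount S a) (lexCount T b) (lexCount S′ a) (lexCount T′ b) (a + ∣ T′ ∣ < b + ∣ S ∩ initSeg i ∣)
shift-gain {i = zero} {S = S} _ q refl = ⊥-elim (¬Split-∅ʳ (subst (Split _ _) (initSeg-zero-─ S) q))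
shift-gain {i = suc zero} last (left q) refl = ⊥-elim (¬Split-∅ʳ (subst (Split _ _) (initSeg-zero-─ ∅) q))
shift-gain {i = suc i} {suc a} {b} (left {V = S} p) (left q) refl (s≤s i≤j) (s≤s ∣S∣≤a) ∣T∣≤b (s≤s a+b<n) a+x≤b+c =
  Gain-+ʳ (withFirst _ b) (Gain-weaken drop (shift-gain p q refl i≤j ∣S∣≤a ∣T∣≤b a+b<n (drop a+x≤b+c)))
  where
  drop : ∀ {z} → suc z ≤ b + suc ∣ S ∩ initSeg i ∣ → z ≤ b + ∣ S ∩ initSeg i ∣
  drop {z} h = ≤-pred (subst (suc z ≤_) (+-suc b _) h)
shift-gain {n = suc n} {i = suc i} {a} {suc b} (right p) (right q) refl (s≤s i≤j) ∣S∣≤a (s≤s ∣T∣≤b) a+1+b<1+n a+x≤b+c =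
  Gain-+ˡ (withFirst n a)
    (Gain-weaken +-suc-< (shift-gain p q refl i≤j ∣S∣≤a ∣T∣≤b (+-suc-< a+1+b<1+n) (+-suc-≤ a+x≤b+c)))
shift-gain {n = suc n} {i = suc i} {a} {suc b} (right {V = S} p) last eq i≤j ∣S∣≤a (s≤s ∣T∣≤b) a+1+b<1+n a+x≤b+c =
  Gain-weaken (λ h → subst (_< b + c) a+∣∅∣≡a (+-suc-< h))
    (Gain-at-max {i = i} p (∷-injectiveʳ eq) ∣S∣≤a ∣T∣≤b (+-suc-< a+1+b<1+n)
                 (subst (_≤ b + c) a+∣∅∣≡a (+-suc-≤ a+x≤b+c)))
  where
  c = ∣ S ∩ initSeg i ∣
  a+∣∅∣≡a : a + ∣ ∅ {n} ∣ ≡ a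
  a+∣∅∣≡a = trans (cong (a +_) (∣⊥∣≡0 n)) (+-identityʳ a)

shift-improves : ∀ {n k j m i} {S T S′ T′ : Subset n} → n > 2 * k → T ⊆ from2 →
  Split j S T → Split m S′ T′ → initSeg i ─ S ≡ T′ → i ≤ elt j →
  ∣ S ∩ from2 ∣ ≤ k ∸ 1 → ∣ T ∣ ≤ k → ∣ T′ ∣ ≤ ∣ S ∩ initSeg i ∣ →
  CrossIntersecting (InL S′ (k ∸ 1)) (InL T′ k)
  × Gain (cardL S (k ∸ 1)) (cardL T k) (cardL S′ (k ∸ 1)) (cardL T′ k) (∣ T′ ∣ < ∣ S ∩ initSeg i ∣)
shift-improves _ T⊆from2 last with T⊆from2 here
... | ()
shift-improves _ T⊆from2 (right _) with T⊆from2 here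
... | ()
shift-improves {k = zero} _ _ (left p) _ _ _ _ ∣T∣≤0 _ = ⊥-elim (<⇒≱ (Split⇒0<∣U∣ p) ∣T∣≤0)
shift-improves {i = zero} {S = true ∷ S} _ _ (left _) (left q) eq =
  ⊥-elim (¬Split-∅ʳ (subst (Split _ _) (trans (sym (∷-injectiveʳ eq)) (initSeg-zero-─ S)) q))
shift-improves {suc n} {suc k} {i = suc i} {true ∷ S} {false ∷ T} {true ∷ S′} {false ∷ T′}
  n>2k _ (left p) (left q) eq i≤j ∣S∣≤k ∣T∣≤1+k x≤1+y
  rewrite cardL-∷ true S k | cardL-∷ false T (suc k) | cardL-∷ true S′ k | cardL-∷ false T′ (suc k) =
  Split⇒crossIntersecting {a = k} {suc k} {true} {false} q
  , Gain-weaken k+x<1+k+y (shift-gain p q (∷-injectiveʳ eq) (≤-pred i≤j) ∣S∣≤k′ ∣T∣≤1+k k+1+k<n k+x≤1+k+y)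
  where
  x = ∣ T′ ∣
  y = ∣ S ∩ initSeg i ∣
  k+x≤1+k+y : k + x ≤ suc k + y
  k+x≤1+k+y = subst (k + x ≤_) (+-suc k y) (+-monoʳ-≤ k x≤1+y)
  k+x<1+k+y : x < suc y → k + x < suc k + y
  k+x<1+k+y x<1+y = subst (k + x <_) (+-suc k y) (+-monoʳ-< k x<1+y)
  ∣S∣≤k′ : ∣ S ∣ ≤ k
  ∣S∣≤k′ = subst (λ X → ∣ X ∣ ≤ k) (∷∩from2 true S) ∣S∣≤k
  k+1+k<n : k + suc k < n
  k+1+k<n = subst (λ z → suc (k + z) ≤ n) (+-identityʳ (suc k)) (≤-pred n>2k)

lemma11 : ∀ (n k : ℕ) → n > 2 * k →
    (S T : Subset n) → T ⊆ from2 →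
    (j : Fin n) → IsMax j T →
    S ∩ T ≡ ⁅ j ⁆ → S ∪ T ≡ initSeg (elt j) →
    ∣ S ∩ from2 ∣ ≤ k ∸ 1 → ∣ T ∣ ≤ k →
    (i : ℕ) → 4 ≤ i → i ≤ elt j →
    ∣ initSeg i ─ S ∣ ≤ ∣ S ∩ initSeg i ∣ →
    (S' : Subset n) (m : Fin n) → IsMax m (initSeg i ─ S) →
    S' ∩ (initSeg i ─ S) ≡ ⁅ m ⁆ → S' ∪ (initSeg i ─ S) ≡ initSeg (elt m) →
    CrossIntersecting (InL S' (k ∸ 1)) (InL (initSeg i ─ S) k)
    × cardL S' (k ∸ 1) + cardL (initSeg i ─ S) k ≥ cardL S (k ∸ 1) + cardL T k
    × cardL (initSeg i ─ S) k > cardL T k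
    × (∣ initSeg i ─ S ∣ < ∣ S ∩ initSeg i ∣ →
       cardL S' (k ∸ 1) + cardL (initSeg i ─ S) k > cardL S (k ∸ 1) + cardL T k)
lemma11 _ _ n>2k _ _ T⊆from2 _ _ S∩T S∪T ∣S∩from2∣≤k∸1 ∣T∣≤k _ _ i≤j ∣T′∣≤∣S∩[i]∣ _ _ _ S′∩T′ S′∪T′
  with shift-improves n>2k T⊆from2 (split S∩T S∪T) (split S′∩T′ S′∪T′) refl i≤j ∣S∩from2∣≤k∸1 ∣T∣≤k ∣T′∣≤∣S∩[i]∣
... | cross , gain sum≤ y<y′ sum< = cross , sum≤ , y<y′ , sum<
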